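{- For all positive integers $m$, $n$, $d$ such that $m$ divides $n$, we have $\alpha_n^d\geq\left(\frac{n}{m}\right)^d\alpha_m^d$.
   Context: $\mathbb{Z}_n$ is the ring of integers modulo $n$; a vector $(v_1,\dots,v_d)\in\mathbb{Z}_n^d$ is zero-sum-free if no non-empty subset of its components sums to $0$ in $\mathbb{Z}_n$; $\alpha_n^d$ is the number of such vectors. -}

module Defs where

open import Data.Nat using (ℕ; zero; suc; _+_)
open import Data.Nat.Divisibility using (_∣_; _∣?_)
open import Data.Fin using (Fin; toℕ)
open import Data.Fin.Subset using (Subset; Nonempty; inside; outside)
open import Data.Fin.Subset.Properties using (anySubset?; nonempty?)
open import Data.Vec using (Vec; []; _∷_; lookup; zipWith; foldr)
open import Data.List using (List; []; _∷_; map; concatMap; length; filter; allFin)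
open import Data.Product using (Σ; ∃; _×_)
open import Data.Bool using (Bool; true; false)
open import Relation.Nullary using (¬_; Dec)
open import Relation.Nullary.Decidable using (¬?; _×-dec_)

-- Z_n is modelled by Fin n (residues 0..n-1); a vector in Z_n^d is Vec (Fin n) d.

subsetSum : ∀ {n d} → Vec (Fin n) d → Subset d → ℕ
subsetSum [] [] = 0
subsetSum (x ∷ v) (true ∷ s) = toℕ x + subsetSum v s
subsetSum (x ∷ v) (false ∷ s) = subsetSum v s

SumsToZero : ∀ {n d} → Vec (Fin n) d → Subset d → Set
SumsToZero {n} v s = n ∣ subsetSum v s

ZeroSumFree : ∀ {n d} → Vec (Fin n) d → Set
ZeroSumFree v = ¬ (∃ λ s → Nonempty s × SumsToZero v s)

zeroSumFree? : ∀ {n d} (v : Vec (Fin n) d) → Dec (ZeroSumFree v)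
zeroSumFree? {n} v = ¬? (anySubset? (λ s → nonempty? s ×-dec (n ∣? subsetSum v s)))

allVecs : ∀ n d → List (Vec (Fin n) d)
allVecs n zero = [] ∷ []
allVecs n (suc d) = concatMap (λ x → map (x ∷_) (allVecs n d)) (allFin n)

α : ℕ → ℕ → ℕ
α n d = length (filter zeroSumFree? (allVecs n d))

-- Reduction mod m maps Z_{km}^d onto Z_m^d with every fibre of size k^d, and it
-- reflects zero sums: if a non-empty subset of the coordinates of x ∈ Z_{km}^d sums
-- to 0 mod km, the same coordinates of the reduction sum to 0 mod m. Hence each
-- zero-sum-free vector of Z_m^d has k^d zero-sum-free preimages in Z_{km}^d.
module Submission where

open import Defs
open import Data.Nat using (ℕ; _*_; _^_; _≤_; NonZero)
open import Data.Nat.Divisibility using (_∣_)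
open import Data.Nat.DivMod using (_/_)

open import Level using (Level)
open import Data.Nat using (zero; suc; _+_)
open import Data.Nat.Properties
  using (*-assoc; *-comm; *-distribˡ-+; *-zeroʳ; +-identityʳ; module ≤-Reasoning)
open import Data.Nat.Divisibility using (divides; ∣-trans; n∣m*n; m∣m*n; ∣m+n∣m⇒∣n)
open import Data.Nat.DivMod using (m*n/n≡m)
open import Data.Nat.ListAction using (sum)
open import Data.Nat.ListAction.Properties using (sum-++)
open import Data.Nat.Tactic.RingSolver using (solve-∀)
open import Data.Fin using (Fin; toℕ; _↑ˡ_; _↑ʳ_; quotient; remainder)
import Data.Fin as Fin
open import Data.Fin.Properties using (combine-remQuot; remQuot-combine; toℕ-combine; splitAt-↑ʳ)
open import Data.Fin.Subset using (Subset)
open import Data.Vec using (Vec; []; _∷_)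
import Data.Vec as Vec
open import Data.List using (List; []; _∷_; _++_; map; concatMap; length; filter; allFin; tabulate)
open import Data.List.Properties using (length-++; filter-++; map-tabulate; tabulate-cong)
open import Data.List.Relation.Binary.Sublist.Propositional using (⊆-refl)
open import Data.List.Relation.Binary.Sublist.Propositional.Properties
  using (filter⁺; length-mono-≤)
open import Data.Bool using (true; false)
open import Data.Product using (_,_; proj₂)
open import Relation.Nullary using (does)
open import Relation.Unary using (Pred; Decidable; _⊆_)
open import Relation.Binary.PropositionalEquality
open import Function using (_∘_; id)

private
  variable
    a ℓ : Level
    A B : Set a

count : {P : Pred A ℓ} → Decidable P → List A → ℕ
count P? = length ∘ filter P?

module _ {P : Pred A ℓ} (P? : Decidable P) where

  count-++ : ∀ xs ys → count P? (xs ++ ys) ≡ count P? xs + count P? ys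
  count-++ xs ys = trans (cong length (filter-++ P? xs ys)) (length-++ (filter P? xs))

  count-map : (f : B → A) (xs : List B) → count P? (map f xs) ≡ count (P? ∘ f) xs
  count-map f [] = refl
  count-map f (x ∷ xs) with does (P? (f x))
  ... | true  = cong suc (count-map f xs)
  ... | false = count-map f xs

  count-concatMap : (f : B → List A) (xs : List B) →
                    count P? (concatMap f xs) ≡ sum (map (count P? ∘ f) xs)
  count-concatMap f [] = refl
  count-concatMap f (x ∷ xs) =
    trans (count-++ (f x) (concatMap f xs)) (cong (count P? (f x) +_) (count-concatMap f xs))

count-mono : {P Q : Pred A ℓ} (P? : Decidable P) (Q? : Decidable Q) →
             P ⊆ Q → ∀ xs → count P? xs ≤ count Q? xs
count-mono P? Q? P⊆Q xs = length-mono-≤ (filter⁺ P? Q? (λ { refl → P⊆Q }) (⊆-refl {x = xs}))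

sum-map-* : ∀ c ns → sum (map (c *_) ns) ≡ c * sum ns
sum-map-* c []       = sym (*-zeroʳ c)
sum-map-* c (n ∷ ns) = trans (cong (c * n +_) (sum-map-* c ns)) (sym (*-distribˡ-+ c n (sum ns)))

tabulate-+ : ∀ m {n} (f : Fin (m + n) → A) →
             tabulate f ≡ tabulate (f ∘ (_↑ˡ n)) ++ tabulate (f ∘ (m ↑ʳ_))
tabulate-+ zero    f = refl
tabulate-+ (suc m) f = cong (f Fin.zero ∷_) (tabulate-+ m (f ∘ Fin.suc))

module _ (m : ℕ) {k : ℕ} where

  toℕ-quotient-remainder : (x : Fin (k * m)) →
                           toℕ x ≡ m * toℕ (quotient {k} m x) + toℕ (remainder {k} m x)
  toℕ-quotient-remainder x =
    trans (cong toℕ (sym (combine-remQuot {k} m x)))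
          (toℕ-combine (quotient {k} m x) (remainder {k} m x))

  remainder-↑ˡ : (i : Fin m) → remainder {suc k} m (i ↑ˡ k * m) ≡ i
  remainder-↑ˡ i = cong proj₂ (remQuot-combine {suc k} Fin.zero i)

  remainder-↑ʳ : (j : Fin (k * m)) → remainder {suc k} m (m ↑ʳ j) ≡ remainder {k} m j
  remainder-↑ʳ j rewrite splitAt-↑ʳ m (k * m) j = refl

sum-tabulate-remainder : ∀ m k (g : Fin m → ℕ) →
                         sum (tabulate (g ∘ remainder {k} m)) ≡ k * sum (tabulate g)
sum-tabulate-remainder m zero    g = refl
sum-tabulate-remainder m (suc k) g = begin
  sum (tabulate (g ∘ remainder {suc k} m))
    ≡⟨ cong sum (tabulate-+ m (g ∘ remainder m)) ⟩
  sum (tabulate (g ∘ remainder {suc k} m ∘ (_↑ˡ k * m))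
       ++ tabulate (g ∘ remainder {suc k} m ∘ (m ↑ʳ_)))
    ≡⟨ sum-++ (tabulate (g ∘ remainder {suc k} m ∘ (_↑ˡ k * m))) _ ⟩
  sum (tabulate (g ∘ remainder {suc k} m ∘ (_↑ˡ k * m)))
    + sum (tabulate (g ∘ remainder {suc k} m ∘ (m ↑ʳ_)))
    ≡⟨ cong₂ _+_ (cong sum (tabulate-cong (cong g ∘ remainder-↑ˡ m {k})))
                 (cong sum (tabulate-cong (cong g ∘ remainder-↑ʳ m {k}))) ⟩
  sum (tabulate g) + sum (tabulate (g ∘ remainder {k} m))
    ≡⟨ cong (sum (tabulate g) +_) (sum-tabulate-remainder m k g) ⟩
  sum (tabulate g) + k * sum (tabulate g)
    ∎
  where open ≡-Reasoning

module _ (m : ℕ) {k : ℕ} where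

  reduce : ∀ {d} → Vec (Fin (k * m)) d → Vec (Fin m) d
  reduce = Vec.map (remainder {k} m)

  subsetSum-quotient-remainder : ∀ {d} (v : Vec (Fin (k * m)) d) (s : Subset d) →
    subsetSum v s ≡ m * subsetSum (Vec.map (quotient {k} m) v) s + subsetSum (reduce v) s
  subsetSum-quotient-remainder []      []          =
    sym (trans (+-identityʳ (m * 0)) (*-zeroʳ m))
  subsetSum-quotient-remainder (x ∷ v) (false ∷ s) = subsetSum-quotient-remainder v s
  subsetSum-quotient-remainder (x ∷ v) (true ∷ s)  =
    trans (cong₂ _+_ (toℕ-quotient-remainder m {k} x) (subsetSum-quotient-remainder v s))
          (regroup m (toℕ (quotient {k} m x)) (toℕ (remainder {k} m x)) _ _)
    where
      regroup : ∀ m q r Q R → (m * q + r) + (m * Q + R) ≡ m * (q + Q) + (r + R)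
      regroup = solve-∀

  zeroSumFree-reduce : ∀ {d} (v : Vec (Fin (k * m)) d) → ZeroSumFree (reduce v) → ZeroSumFree v
  zeroSumFree-reduce v zsf (s , s≢∅ , km∣Σ) = zsf (s , s≢∅ , m∣Σ′)
    where
      m∣Σ′ : m ∣ subsetSum (reduce v) s
      m∣Σ′ = ∣m+n∣m⇒∣n
        (subst (m ∣_) (subsetSum-quotient-remainder v s) (∣-trans (n∣m*n k) km∣Σ))
        (m∣m*n _)

count-allVecs-suc : ∀ n d {P : Pred (Vec (Fin n) (suc d)) ℓ} (P? : Decidable P) →
  count P? (allVecs n (suc d)) ≡ sum (tabulate (λ x → count (P? ∘ (x ∷_)) (allVecs n d)))
count-allVecs-suc n d P? = begin
  count P? (allVecs n (suc d))
    ≡⟨ count-concatMap P? (λ x → map (x ∷_) (allVecs n d)) (allFin n) ⟩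
  sum (map (λ x → count P? (map (x ∷_) (allVecs n d))) (allFin n))
    ≡⟨ cong sum (map-tabulate {n = n} id _) ⟩
  sum (tabulate (λ x → count P? (map (x ∷_) (allVecs n d))))
    ≡⟨ cong sum (tabulate-cong (λ x → count-map P? (x ∷_) (allVecs n d))) ⟩
  sum (tabulate (λ x → count (P? ∘ (x ∷_)) (allVecs n d)))
    ∎
  where open ≡-Reasoning

count-reduce : ∀ m k d {P : Pred (Vec (Fin m) d) ℓ} (P? : Decidable P) →
  count (P? ∘ reduce m {k}) (allVecs (k * m) d) ≡ k ^ d * count P? (allVecs m d)
count-reduce m k zero    P? with does (P? [])
... | true  = refl
... | false = refl
count-reduce m k (suc d) P? = begin
  count (P? ∘ reduce m {k}) (allVecs (k * m) (suc d))
    ≡⟨ count-allVecs-suc (k * m) d (P? ∘ reduce m {k}) ⟩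
  sum (tabulate (λ x → count (P? ∘ reduce m {k} ∘ (x ∷_)) (allVecs (k * m) d)))
    ≡⟨ cong sum (tabulate-cong (λ x → count-reduce m k d (P? ∘ (remainder {k} m x ∷_)))) ⟩
  sum (tabulate (λ x → k ^ d * h (remainder {k} m x)))
    ≡⟨ cong sum (map-tabulate (h ∘ remainder {k} m) (k ^ d *_)) ⟨
  sum (map (k ^ d *_) (tabulate (h ∘ remainder {k} m)))
    ≡⟨ sum-map-* (k ^ d) (tabulate (h ∘ remainder {k} m)) ⟩
  k ^ d * sum (tabulate (h ∘ remainder {k} m))
    ≡⟨ cong (k ^ d *_) (sum-tabulate-remainder m k h) ⟩
  k ^ d * (k * sum (tabulate h))
    ≡⟨ *-assoc (k ^ d) k _ ⟨
  k ^ d * k * sum (tabulate h)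
    ≡⟨ cong₂ _*_ (*-comm k (k ^ d)) (count-allVecs-suc m d P?) ⟨
  k ^ suc d * count P? (allVecs m (suc d))
    ∎
  where
    open ≡-Reasoning
    h : Fin m → ℕ
    h y = count (P? ∘ (y ∷_)) (allVecs m d)

proposition5p3 : (m n d : ℕ) → .{{_ : NonZero m}} → .{{_ : NonZero n}} → .{{_ : NonZero d}} →
                   m ∣ n → (n / m) ^ d * α m d ≤ α n d
proposition5p3 m _ d (divides k refl) = begin
  (k * m / m) ^ d * α m d
    ≡⟨ cong (λ t → t ^ d * α m d) (m*n/n≡m k m) ⟩
  k ^ d * α m d
    ≡⟨ count-reduce m k d zeroSumFree? ⟨
  count (zeroSumFree? ∘ reduce m {k}) (allVecs (k * m) d)
    ≤⟨ count-mono (zeroSumFree? ∘ reduce m {k}) zeroSumFree?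
                  (λ {v} → zeroSumFree-reduce m {k} v) (allVecs (k * m) d) ⟩
  α (k * m) d
    ∎
  where open ≤-Reasoning
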